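{- The randomized algorithm that, independently for each node $u\in V$, sets $\ell(u)=\ell_{u,\min}$ with probability $\frac12$ and $\ell(u)=\ell_{u,\max}$ otherwise, has approximation factor at least $4$ for RMAS: for every $\varepsilon>0$ there exists an RMAS instance (satisfying $\ell_{u,\min}<\ell_{u',\max}$ for every edge $(u,u')$) on which the profit of the labeling returned by the algorithm is at most $(\frac14+\varepsilon)$ times the optimum profit.
   Context: RMAS: the input is a directed graph $G=(V,E)$ with non-negative edge weights $\{w_e\}_{e\in E}$ and, for each node $v\in V$, an explicitly given finite nonempty set $L_v$ of integer labels. A feasible solution is a labeling $\ell$ with $\ell(v)\in L_v$ for all $v$; its profit is $\sum_{e=(u,v)\in E,\ \ell(u)<\ell(v)} w_e$; the optimum is the maximum profit over feasible labelings. For $u\in V$, $\ell_{u,\min}=\min L_u$ and $\ell_{u,\max}=\max L_u$. -}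

module Defs where

open import Data.Nat using (ℕ; zero; suc)
open import Data.Fin using (Fin; zero; suc)
open import Data.Bool using (Bool; true; false; if_then_else_)
import Data.Integer
open import Data.Integer using (ℤ; _<?_) renaming (_⊓_ to _⊓ℤ_; _⊔_ to _⊔ℤ_)
open import Data.Rational using (ℚ; 0ℚ; 1ℚ; _≤_; ½; _+_; _*_; _⊔_)
open import Data.List using (List; []; _∷_; map; concatMap; foldr)
open import Data.List.NonEmpty using (List⁺; foldr₁; toList)
open import Data.Product using (_×_; _,_)
open import Relation.Nullary using (does; ¬_)
open import Relation.Binary.PropositionalEquality using (_≡_)
open import Data.List.Relation.Unary.All using (All)
open import Data.List.Relation.Unary.Unique.Propositional using (Unique)

-- An RMAS instance on the node set V = Fin n.
-- Edges: a list of (tail , head , weight) triples.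
-- Label sets: each node v has an explicitly given finite nonempty set L v of integers.
record Instance (n : ℕ) : Set where
  field
    edges  : List (Fin n × Fin n × ℚ)
    labels : Fin n → List⁺ ℤ
open Instance public

Labeling : ℕ → Set
Labeling n = Fin n → ℤ

ℓmin : {n : ℕ} → Instance n → Fin n → ℤ
ℓmin I u = foldr₁ _⊓ℤ_ (labels I u)

ℓmax : {n : ℕ} → Instance n → Fin n → ℤ
ℓmax I u = foldr₁ _⊔ℤ_ (labels I u)

profit : {n : ℕ} → Instance n → Labeling n → ℚ
profit I ℓ = foldr (λ { (u , v , w) acc → (if does (ℓ u <? ℓ v) then w else 0ℚ) + acc }) 0ℚ (edges I)

allChoices : {A : Set} (n : ℕ) → (Fin n → List A) → List (Fin n → A)
allChoices zero    C = (λ ()) ∷ []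
allChoices (suc n) C =
  concatMap (λ a → map (λ f → λ { zero → a ; (suc i) → f i }) (allChoices n (λ i → C (suc i)))) (C zero)

feasibleLabelings : {n : ℕ} → Instance n → List (Labeling n)
feasibleLabelings {n} I = allChoices n (λ v → toList (labels I v))

-- optimum profit: maximum of the profit over all feasible labelings
-- (profits are nonnegative and the list is nonempty, so starting the fold at 0 is harmless)
OPT : {n : ℕ} → Instance n → ℚ
OPT I = foldr _⊔_ 0ℚ (map (profit I) (feasibleLabelings I))

halfPow : ℕ → ℚ
halfPow zero    = 1ℚ
halfPow (suc k) = ½ * halfPow k

sumℚ : List ℚ → ℚ
sumℚ = foldr _+_ 0ℚ

coinLabeling : {n : ℕ} → Instance n → (Fin n → Bool) → Labeling n
coinLabeling I σ u = if σ u then ℓmax I u else ℓmin I u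

-- expected profit of the randomized algorithm: each node independently
-- receives ℓ_min or ℓ_max with probability 1/2 each; average over all 2^n outcomes
expectedProfit : {n : ℕ} → Instance n → ℚ
expectedProfit {n} I =
  halfPow n * sumℚ (map (λ σ → profit I (coinLabeling I σ)) (allChoices n (λ _ → false ∷ true ∷ [])))

-- G is a directed graph (no self-loops, no parallel edges) with nonnegative weights
WellFormed : {n : ℕ} → Instance n → Set
WellFormed I =
  All (λ { (u , v , w) → (¬ u ≡ v) × (0ℚ ≤ w) }) (edges I)
  × Unique (map (λ { (u , v , w) → (u , v) }) (edges I))

EdgeCondition : {n : ℕ} → Instance n → Set
EdgeCondition I = All (λ { (u , v , w) → ℓmin I u Data.Integer.< ℓmax I v }) (edges I)

-- A single edge u → v of weight 1 with L u = L v = {0, 1} already attains the factor 4: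
-- the optimum labels u with 0 and v with 1, while of the four equally likely coin
-- outcomes only (ℓ_min, ℓ_max) gains the edge, so the expected profit is exactly 1/4.
module Submission where

open import Defs
open import Data.Nat using (ℕ; z≤n; s≤s)
open import Data.Integer using (+_; +<+)
open import Data.Rational using (ℚ; 0ℚ; 1ℚ; _<_; _≤_; _+_; _*_; _/_)
open import Data.Rational.Properties
  using (nonNegative⁻¹; positive⁻¹; <⇒≤; +-monoʳ-≤; +-identityʳ; *-identityʳ)
open import Data.Product using (Σ; _×_; _,_)
open import Data.Fin using (zero; suc)
open import Data.List using ([]; _∷_)
open import Data.List.NonEmpty using (_∷_)
open import Data.List.Relation.Unary.All using ([]; _∷_)
open import Data.List.Relation.Unary.AllPairs using ([]; _∷_)
open import Relation.Binary.PropositionalEquality using (_≡_; refl; subst)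

singleEdge : Instance 2
singleEdge = record
  { edges  = (zero , suc zero , 1ℚ) ∷ []
  ; labels = λ _ → + 0 ∷ + 1 ∷ []
  }

singleEdge-wellFormed : WellFormed singleEdge
singleEdge-wellFormed = ((λ ()) , nonNegative⁻¹ 1ℚ) ∷ [] , [] ∷ []

singleEdge-edgeCondition : EdgeCondition singleEdge
singleEdge-edgeCondition = +<+ (s≤s z≤n) ∷ []

OPT-singleEdge : OPT singleEdge ≡ 1ℚ
OPT-singleEdge = refl

expectedProfit-singleEdge : expectedProfit singleEdge ≡ + 1 / 4
expectedProfit-singleEdge = refl

p≤p+ε : ∀ p {ε} → 0ℚ < ε → p ≤ p + ε
p≤p+ε p ε>0 = subst (_≤ p + _) (+-identityʳ p) (+-monoʳ-≤ p (<⇒≤ ε>0))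

lemma2 : (ε : ℚ) → 0ℚ < ε →
    Σ ℕ (λ n → Σ (Instance n) (λ I →
      WellFormed I × EdgeCondition I × (0ℚ < OPT I)
      × (expectedProfit I ≤ ((+ 1 / 4) + ε) * OPT I)))
lemma2 ε ε>0 =
  2 , singleEdge , singleEdge-wellFormed , singleEdge-edgeCondition , positive⁻¹ 1ℚ , bound
  where
  bound : expectedProfit singleEdge ≤ ((+ 1 / 4) + ε) * OPT singleEdge
  bound rewrite OPT-singleEdge | expectedProfit-singleEdge | *-identityʳ ((+ 1 / 4) + ε) =
    p≤p+ε (+ 1 / 4) ε>0
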